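{- Let $p$ be a pattern of length $\ell$ with least period $s$, and let $t$ be a period of $p$ not divisible by $s$. Then $t\ge \ell/(q+2)+1$.
   Context: Let $\mathcal{A}$ be a finite alphabet with $q$ letters and $G$ a subgroup of the symmetric group on $\mathcal{A}$, acting on words letterwise. A pattern is a $G$-orbit of words, represented by its lexicographically least word $p=p(1)\cdots p(\ell)$, with $p(i,j)=p(i)\cdots p(j)$. A pattern $p$ of length $\ell$ has period $i$ ($1\le i\le\ell-1$) if there exists $g\in G$ with $g\cdot p(1,\ell-i)=p(i+1,\ell)$; the least period is the smallest such $i$. -}

module Defs where

open import Level using (Level; suc; _⊔_)
open import Data.Nat using (ℕ; _+_; _≤_; _<_)
open import Data.Fin using (Fin; toℕ) renaming (_<_ to _<ᶠ_)
open import Data.Fin.Permutation using (Permutation′; _⟨$⟩ʳ_; id; flip; _∘ₚ_; _≈_)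
open import Data.Product using (Σ; ∃; _×_)
open import Relation.Binary.PropositionalEquality using (_≡_)
open import Relation.Nullary using (¬_)

record Subgroup (q : ℕ) : Set₁ where
  field
    Mem      : Permutation′ q → Set
    resp     : ∀ {g h} → g ≈ h → Mem g → Mem h
    id-mem   : Mem id
    comp-mem : ∀ {g h} → Mem g → Mem h → Mem (g ∘ₚ h)
    inv-mem  : ∀ {g} → Mem g → Mem (flip g)
open Subgroup public

Word : ℕ → ℕ → Set
Word q ℓ = Fin ℓ → Fin q

act : ∀ {q ℓ} → Permutation′ q → Word q ℓ → Word q ℓ
act g w k = g ⟨$⟩ʳ w k

_<lex_ : ∀ {q ℓ} → Word q ℓ → Word q ℓ → Set
_<lex_ {q} {ℓ} w v = Σ (Fin ℓ) λ i → (∀ (j : Fin ℓ) → toℕ j < toℕ i → w j ≡ v j) × (w i <ᶠ v i)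

IsPattern : ∀ {q ℓ} → Subgroup q → Word q ℓ → Set
IsPattern {q} G p = ∀ (g : Permutation′ q) → Mem G g → ¬ (act g p <lex p)

-- p has period i: 1 ≤ i ≤ ℓ-1 and some g ∈ G maps p(1,ℓ-i) onto p(i+1,ℓ)
-- (0-based: g (p k) = p (k + i) for all k with k + i < ℓ)
HasPeriod : ∀ {q ℓ} → Subgroup q → Word q ℓ → ℕ → Set
HasPeriod {q} {ℓ} G p i =
  1 ≤ i × i < ℓ ×
  Σ (Permutation′ q) λ g → Mem G g ×
    (∀ (k j : Fin ℓ) → toℕ j ≡ toℕ k + i → g ⟨$⟩ʳ p k ≡ p j)

IsLeastPeriod : ∀ {q ℓ} → Subgroup q → Word q ℓ → ℕ → Set
IsLeastPeriod G p s = HasPeriod G p s × (∀ i → i < s → ¬ HasPeriod G p i)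

-- Let g and h realise the periods s < t. If t is small, the word is long compared to s and t,
-- so every letter already occurs at a position j with j + s + t < ℓ: among the q + 1 positions
-- k - qs, k - (q-1)s, ..., k two carry the same letter, and a power of g carries this coincidence
-- to an earlier occurrence of the letter at k. Hence g and h commute on every letter of p.
-- Writing t = ms + r, the identity g^m p(k + r) = h p(k) holds for k + t < ℓ by the periods
-- themselves, and for larger k by pulling it back from k - t with the commutation. So h g^-m
-- realises the period r < s, and r ≠ 0 because s ∤ t.
module Submission where

open import Defs
open import Data.Nat using (ℕ; _+_; _*_; _≤_)
open import Data.Nat.Divisibility using (_∣_)
open import Relation.Nullary using (¬_)

open import Data.Empty using (⊥-elim)
open import Data.Fin using (Fin; toℕ; fromℕ<)
open import Data.Fin.Permutation using (Permutation′; _⟨$⟩ʳ_; inverseˡ; id; flip; _∘ₚ_)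
open import Data.Fin.Properties using (pigeonhole; toℕ<n; toℕ-fromℕ<; fromℕ<-toℕ)
open import Data.Nat using (zero; suc; z≤n; s≤s; _<_; _<?_; _≤?_; >-nonZero; _/_; _%_)
open import Data.Nat.DivMod using (m≡m%n+[m/n]*n; m%n<n)
open import Data.Nat.Divisibility using (m%n≡0⇒n∣m; ∣-refl)
open import Data.Nat.Induction using (<-rec)
open import Data.Nat.Properties
open import Algebra.Properties.CommutativeSemigroup +-commutativeSemigroup using (xy∙z≈xz∙y)
open import Data.Nat.Tactic.RingSolver using (solve-∀)
open import Data.Product using (∃; _×_; _,_; proj₁; proj₂)
open import Relation.Binary.PropositionalEquality
open import Relation.Nullary using (yes; no)

infix 10 _^ₚ_

_^ₚ_ : ∀ {q} → Permutation′ q → ℕ → Permutation′ q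
g ^ₚ zero = id
g ^ₚ suc a = g ∘ₚ g ^ₚ a

^ₚ-mem : ∀ {q} (G : Subgroup q) {g} → Mem G g → ∀ a → Mem G (g ^ₚ a)
^ₚ-mem G g∈G zero = id-mem G
^ₚ-mem G g∈G (suc a) = comp-mem G g∈G (^ₚ-mem G g∈G a)

^ₚ-comm-on : ∀ {q} {L : Fin q → Set} {g h : Permutation′ q} →
  (∀ {x} → L x → L (g ⟨$⟩ʳ x)) →
  (∀ {x} → L x → g ⟨$⟩ʳ (h ⟨$⟩ʳ x) ≡ h ⟨$⟩ʳ (g ⟨$⟩ʳ x)) →
  ∀ a {x} → L x → (g ^ₚ a) ⟨$⟩ʳ (h ⟨$⟩ʳ x) ≡ h ⟨$⟩ʳ ((g ^ₚ a) ⟨$⟩ʳ x)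
^ₚ-comm-on closed comm zero x∈L = refl
^ₚ-comm-on {g = g} {h} closed comm (suc a) x∈L =
  trans (cong (g ^ₚ a ⟨$⟩ʳ_) (comm x∈L)) (^ₚ-comm-on {g = g} {h} closed comm a (closed x∈L))

Shifts : ∀ {q} → (ℕ → Fin q) → ℕ → Permutation′ q → ℕ → Set
Shifts P n g s = ∀ k → k + s < n → g ⟨$⟩ʳ P k ≡ P (k + s)

module _ {q} {P : ℕ → Fin q} {n : ℕ} where

  Shifts-^ₚ : ∀ {g s} → Shifts P n g s → ∀ a → Shifts P n (g ^ₚ a) (a * s)
  Shifts-^ₚ g-shift zero k _ = cong P (sym (+-identityʳ k))
  Shifts-^ₚ {g} {s} g-shift (suc a) k k+s+as<n = begin
    g ^ₚ a ⟨$⟩ʳ (g ⟨$⟩ʳ P k)  ≡⟨ cong (g ^ₚ a ⟨$⟩ʳ_) (g-shift k (≤-<-trans (+-monoʳ-≤ k (m≤m+n s (a * s))) k+s+as<n)) ⟩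
    g ^ₚ a ⟨$⟩ʳ P (k + s)      ≡⟨ Shifts-^ₚ g-shift a (k + s) (subst (_< n) (sym (+-assoc k s (a * s))) k+s+as<n) ⟩
    P (k + s + a * s)          ≡⟨ cong P (+-assoc k s (a * s)) ⟩
    P (k + (s + a * s))        ∎
    where open ≡-Reasoning

  repeats-earlier : ∀ {g s k} → Shifts P n g s → 1 ≤ s → q * s ≤ k → k < n →
                    ∃ λ k′ → k′ < k × P k′ ≡ P k
  repeats-earlier {g} {s} {k} g-shift 1≤s qs≤k k<n
    with o , qs+o≡k ← m≤n⇒∃[o]m+o≡n qs≤k
    with i , j , i<j , same ← pigeonhole (n<1+n q) (λ i → P (o + toℕ i * s))
    with c , b+c≡q ← m≤n⇒∃[o]m+o≡n (≤-pred (toℕ<n j))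
    = o + toℕ i * s + c * s , earlier , (begin
        P (o + a * s + c * s)           ≡⟨ Shifts-^ₚ g-shift c (o + a * s) (<-trans earlier k<n) ⟨
        g ^ₚ c ⟨$⟩ʳ P (o + a * s)      ≡⟨ cong (g ^ₚ c ⟨$⟩ʳ_) same ⟩
        g ^ₚ c ⟨$⟩ʳ P (o + b * s)      ≡⟨ Shifts-^ₚ g-shift c (o + b * s) (subst (_< n) (sym o+bs+cs≡k) k<n) ⟩
        P (o + b * s + c * s)           ≡⟨ cong P o+bs+cs≡k ⟩
        P k                             ∎)
    where
    open ≡-Reasoning
    instance _ = >-nonZero 1≤s
    a = toℕ i
    b = toℕ j
    o+bs+cs≡k : o + b * s + c * s ≡ k
    o+bs+cs≡k = begin
      o + b * s + c * s   ≡⟨ +-assoc o (b * s) (c * s) ⟩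
      o + (b * s + c * s) ≡⟨ cong (o +_) (*-distribʳ-+ s b c) ⟨
      o + (b + c) * s     ≡⟨ cong (λ x → o + x * s) b+c≡q ⟩
      o + q * s           ≡⟨ +-comm o (q * s) ⟩
      q * s + o           ≡⟨ qs+o≡k ⟩
      k                   ∎
    earlier : o + a * s + c * s < k
    earlier = subst (o + a * s + c * s <_) o+bs+cs≡k
                (+-monoˡ-< (c * s) (+-monoʳ-< o (*-monoˡ-< s i<j)))

  occurs-early : ∀ {g s d} → Shifts P n g s → 1 ≤ s → q * s + d ≤ n →
                 ∀ k → k < n → ∃ λ j → j + d < n × P j ≡ P k
  occurs-early {g} {s} {d} g-shift 1≤s long = <-rec _ step
    where
    step : ∀ k → (∀ {k′} → k′ < k → k′ < n → ∃ λ j → j + d < n × P j ≡ P k′) →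
           k < n → ∃ λ j → j + d < n × P j ≡ P k
    step k earlier k<n with k + d <? n
    ... | yes k+d<n = k , k+d<n , refl
    ... | no k+d≮n
      with k′ , k′<k , Pk′≡Pk ← repeats-earlier {g} g-shift 1≤s
                                  (+-cancelʳ-≤ d (q * s) k (≤-trans long (≮⇒≥ k+d≮n))) k<n
      with j , j+d<n , Pj≡Pk′ ← earlier k′<k (<-trans k′<k k<n)
      = j , j+d<n , trans Pj≡Pk′ Pk′≡Pk

  Shifts-comm : ∀ {g h s t} → Shifts P n g s → Shifts P n h t →
                ∀ j → j + (s + t) < n → g ⟨$⟩ʳ (h ⟨$⟩ʳ P j) ≡ h ⟨$⟩ʳ (g ⟨$⟩ʳ P j)
  Shifts-comm {g} {h} {s} {t} g-shift h-shift j j+[s+t]<n = begin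
    g ⟨$⟩ʳ (h ⟨$⟩ʳ P j)  ≡⟨ cong (g ⟨$⟩ʳ_) (h-shift j (≤-<-trans (m≤m+n (j + t) s) j+t+s<n)) ⟩
    g ⟨$⟩ʳ P (j + t)      ≡⟨ g-shift (j + t) j+t+s<n ⟩
    P (j + t + s)         ≡⟨ cong P (xy∙z≈xz∙y j t s) ⟩
    P (j + s + t)         ≡⟨ h-shift (j + s) (subst (_< n) (sym (+-assoc j s t)) j+[s+t]<n) ⟨
    h ⟨$⟩ʳ P (j + s)      ≡⟨ cong (h ⟨$⟩ʳ_) (g-shift j (≤-<-trans (+-monoʳ-≤ j (m≤m+n s t)) j+[s+t]<n)) ⟨
    h ⟨$⟩ʳ (g ⟨$⟩ʳ P j)  ∎
    where
    open ≡-Reasoning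
    j+t+s<n : j + t + s < n
    j+t+s<n = subst (_< n) (trans (cong (j +_) (+-comm s t)) (sym (+-assoc j t s))) j+[s+t]<n

  module TwoPeriods {g h s t} (g-shift : Shifts P n g s) (h-shift : Shifts P n h t)
                    (1≤s : 1 ≤ s) (1≤t : 1 ≤ t) (long : q * s + (s + t) ≤ n) where

    Letter : Fin q → Set
    Letter x = ∃ λ k → k < n × P k ≡ x

    g-closed : ∀ {x} → Letter x → Letter (g ⟨$⟩ʳ x)
    g-closed (k , k<n , refl)
      with j , j+[s+t]<n , Pj≡Pk ← occurs-early {g} g-shift 1≤s long k k<n =
      j + s , j+s<n , trans (sym (g-shift j j+s<n)) (cong (g ⟨$⟩ʳ_) Pj≡Pk)
      where
      j+s<n : j + s < n
      j+s<n = ≤-<-trans (+-monoʳ-≤ j (m≤m+n s t)) j+[s+t]<n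

    comm-on-letters : ∀ {x} → Letter x → g ⟨$⟩ʳ (h ⟨$⟩ʳ x) ≡ h ⟨$⟩ʳ (g ⟨$⟩ʳ x)
    comm-on-letters (k , k<n , refl)
      with j , j+[s+t]<n , Pj≡Pk ← occurs-early {g} g-shift 1≤s long k k<n =
      subst (λ x → g ⟨$⟩ʳ (h ⟨$⟩ʳ x) ≡ h ⟨$⟩ʳ (g ⟨$⟩ʳ x)) Pj≡Pk
        (Shifts-comm {g} {h} g-shift h-shift j j+[s+t]<n)

    module _ {r m} (t≡r+ms : t ≡ r + m * s) (t+t≤n : t + t ≤ n) where

      remainder-shift : ∀ k → k + r < n → g ^ₚ m ⟨$⟩ʳ P (k + r) ≡ h ⟨$⟩ʳ P k
      remainder-shift = <-rec _ step
        where
        open ≡-Reasoning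
        step : ∀ k → (∀ {k′} → k′ < k → k′ + r < n → g ^ₚ m ⟨$⟩ʳ P (k′ + r) ≡ h ⟨$⟩ʳ P k′) →
               k + r < n → g ^ₚ m ⟨$⟩ʳ P (k + r) ≡ h ⟨$⟩ʳ P k
        step k earlier k+r<n with k + t <? n
        ... | yes k+t<n = begin
          g ^ₚ m ⟨$⟩ʳ P (k + r)  ≡⟨ Shifts-^ₚ g-shift m (k + r) (subst (_< n) k+t≡k+r+ms k+t<n) ⟩
          P (k + r + m * s)       ≡⟨ cong P k+t≡k+r+ms ⟨
          P (k + t)               ≡⟨ h-shift k k+t<n ⟨
          h ⟨$⟩ʳ P k             ∎
          where
          k+t≡k+r+ms : k + t ≡ k + r + m * s
          k+t≡k+r+ms = trans (cong (k +_) t≡r+ms) (sym (+-assoc k r (m * s)))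
        ... | no k+t≮n
          with k′ , t+k′≡k ← m≤n⇒∃[o]m+o≡n (+-cancelʳ-≤ t t k (≤-trans t+t≤n (≮⇒≥ k+t≮n))) = begin
          g ^ₚ m ⟨$⟩ʳ P (k + r)               ≡⟨ cong (λ i → g ^ₚ m ⟨$⟩ʳ P i) k′+r+t≡k+r ⟨
          g ^ₚ m ⟨$⟩ʳ P (k′ + r + t)          ≡⟨ cong (g ^ₚ m ⟨$⟩ʳ_) (h-shift (k′ + r) k′+r+t<n) ⟨
          g ^ₚ m ⟨$⟩ʳ (h ⟨$⟩ʳ P (k′ + r))    ≡⟨ ^ₚ-comm-on {L = Letter} {g} {h} g-closed comm-on-letters m (k′ + r , k′+r<n , refl) ⟩
          h ⟨$⟩ʳ (g ^ₚ m ⟨$⟩ʳ P (k′ + r))    ≡⟨ cong (h ⟨$⟩ʳ_) (earlier k′<k k′+r<n) ⟩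
          h ⟨$⟩ʳ (h ⟨$⟩ʳ P k′)               ≡⟨ cong (h ⟨$⟩ʳ_) (h-shift k′ (subst (_< n) (sym k′+t≡k) k<n)) ⟩
          h ⟨$⟩ʳ P (k′ + t)                   ≡⟨ cong (λ i → h ⟨$⟩ʳ P i) k′+t≡k ⟩
          h ⟨$⟩ʳ P k                          ∎
          where
          k′+t≡k : k′ + t ≡ k
          k′+t≡k = trans (+-comm k′ t) t+k′≡k
          k′+r+t≡k+r : k′ + r + t ≡ k + r
          k′+r+t≡k+r = trans (xy∙z≈xz∙y k′ r t) (cong (_+ r) k′+t≡k)
          k′+r+t<n : k′ + r + t < n
          k′+r+t<n = subst (_< n) (sym k′+r+t≡k+r) k+r<n
          k′+r<n : k′ + r < n
          k′+r<n = ≤-<-trans (m≤m+n (k′ + r) t) k′+r+t<n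
          k<n : k < n
          k<n = ≤-<-trans (m≤m+n k r) k+r<n
          k′<k : k′ < k
          k′<k = subst (k′ <_) k′+t≡k (m<m+n k′ 1≤t)

      remainder-period : Shifts P n (h ∘ₚ flip (g ^ₚ m)) r
      remainder-period k k+r<n =
        trans (cong (flip (g ^ₚ m) ⟨$⟩ʳ_) (sym (remainder-shift k k+r<n))) (inverseˡ (g ^ₚ m))

module _ {q n} (p : Word q (suc n)) where

  -- Positions past the end read as the first letter; no lemma looks at them.
  extend : ℕ → Fin q
  extend k with k <? suc n
  ... | yes k<ℓ = p (fromℕ< k<ℓ)
  ... | no _ = p Data.Fin.zero

  extend-fromℕ< : ∀ k (k<ℓ : k < suc n) → extend k ≡ p (fromℕ< k<ℓ)
  extend-fromℕ< k k<ℓ with k <? suc n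
  ... | yes _ = refl
  ... | no k≮ℓ = ⊥-elim (k≮ℓ k<ℓ)

  extend-toℕ : ∀ i → extend (toℕ i) ≡ p i
  extend-toℕ i = trans (extend-fromℕ< (toℕ i) (toℕ<n i)) (cong p (fromℕ<-toℕ i (toℕ<n i)))

  module _ {g : Permutation′ q} {s : ℕ} where

    Shifts-extend⁺ : (∀ k j → toℕ j ≡ toℕ k + s → g ⟨$⟩ʳ p k ≡ p j) → Shifts extend (suc n) g s
    Shifts-extend⁺ shift k k+s<ℓ = begin
      g ⟨$⟩ʳ extend k                    ≡⟨ cong (g ⟨$⟩ʳ_) (extend-fromℕ< k k<ℓ) ⟩
      g ⟨$⟩ʳ p (fromℕ< k<ℓ)             ≡⟨ shift (fromℕ< k<ℓ) (fromℕ< k+s<ℓ) positions ⟩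
      p (fromℕ< k+s<ℓ)                  ≡⟨ extend-fromℕ< (k + s) k+s<ℓ ⟨
      extend (k + s)                     ∎
      where
      open ≡-Reasoning
      k<ℓ : k < suc n
      k<ℓ = ≤-<-trans (m≤m+n k s) k+s<ℓ
      positions : toℕ (fromℕ< k+s<ℓ) ≡ toℕ (fromℕ< k<ℓ) + s
      positions = trans (toℕ-fromℕ< k+s<ℓ) (cong (_+ s) (sym (toℕ-fromℕ< k<ℓ)))

    Shifts-extend⁻ : Shifts extend (suc n) g s → ∀ k j → toℕ j ≡ toℕ k + s → g ⟨$⟩ʳ p k ≡ p j
    Shifts-extend⁻ shift k j j≡k+s = begin
      g ⟨$⟩ʳ p k              ≡⟨ cong (g ⟨$⟩ʳ_) (extend-toℕ k) ⟨
      g ⟨$⟩ʳ extend (toℕ k)   ≡⟨ shift (toℕ k) (subst (_< suc n) j≡k+s (toℕ<n j)) ⟩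
      extend (toℕ k + s)      ≡⟨ cong extend j≡k+s ⟨
      extend (toℕ j)          ≡⟨ extend-toℕ j ⟩
      p j                     ∎
      where open ≡-Reasoning

remainder-hasPeriod : ∀ {q ℓ} {G : Subgroup q} {p : Word q ℓ} {s t r m} →
  HasPeriod G p s → HasPeriod G p t → q * s + (s + t) ≤ ℓ → t + t ≤ ℓ →
  t ≡ r + m * s → 1 ≤ r → HasPeriod G p r
remainder-hasPeriod {ℓ = zero} _ (_ , () , _) _ _ _ _
remainder-hasPeriod {ℓ = suc n} {G} {p} {s} {t} {r} {m}
  (1≤s , _ , g , g∈G , g-shift) (1≤t , t<ℓ , h , h∈G , h-shift) long t+t≤ℓ t≡r+ms 1≤r =
  1≤r , r<ℓ , h ∘ₚ flip (g ^ₚ m) , comp-mem G h∈G (inv-mem G (^ₚ-mem G g∈G m)) ,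
  Shifts-extend⁻ p {h ∘ₚ flip (g ^ₚ m)} (TwoPeriods.remainder-period {g = g} {h}
    (Shifts-extend⁺ p {g} g-shift) (Shifts-extend⁺ p {h} h-shift) 1≤s 1≤t long {r} {m} t≡r+ms t+t≤ℓ)
  where
  r<ℓ : r < suc n
  r<ℓ = ≤-<-trans (subst (r ≤_) (sym t≡r+ms) (m≤m+n r (m * s))) t<ℓ

least-period-≤ : ∀ {q ℓ} {G : Subgroup q} {p : Word q ℓ} {s t} →
                 IsLeastPeriod G p s → HasPeriod G p t → s ≤ t
least-period-≤ {s = s} {t} (_ , least) t-period with t <? s
... | yes t<s = ⊥-elim (least t t<s t-period)
... | no t≮s = ≮⇒≥ t≮s

+-cancelʳ-≤-< : ∀ {x c y ℓ} → x + c ≤ y → y < ℓ + suc c → x ≤ ℓ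
+-cancelʳ-≤-< {x} {c} {y} {ℓ} x+c≤y y<ℓ+1+c =
  +-cancelʳ-≤ c x ℓ (≤-pred (≤-trans (s≤s x+c≤y) (subst (suc y ≤_) (+-suc ℓ c) y<ℓ+1+c)))

short-period⇒long-word : ∀ {q s t ℓ} → 1 ≤ q → 1 ≤ s → s < t → (q + 2) * t < ℓ + (q + 2) →
                         q * s + (s + t) ≤ ℓ × t + t ≤ ℓ
short-period⇒long-word {q} {s} {t} {ℓ} 1≤q 1≤s s<t short =
  +-cancelʳ-≤-< first-fits short′ , +-cancelʳ-≤-< second-fits short′
  where
  open ≤-Reasoning
  short′ : (q + 2) * t < ℓ + suc (q + 1)
  short′ = subst (λ c → (q + 2) * t < ℓ + c) (+-suc q 1) short
  first-fits : q * s + (s + t) + (q + 1) ≤ (q + 2) * t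
  first-fits = begin
    q * s + (s + t) + (q + 1) ≡⟨ lhs q s t ⟩
    (q + 1) * (1 + s) + t     ≤⟨ +-monoˡ-≤ t (*-monoʳ-≤ (q + 1) s<t) ⟩
    (q + 1) * t + t           ≡⟨ rhs q t ⟩
    (q + 2) * t               ∎
    where
    lhs : ∀ q s t → q * s + (s + t) + (q + 1) ≡ (q + 1) * (1 + s) + t
    lhs = solve-∀
    rhs : ∀ q t → (q + 1) * t + t ≡ (q + 2) * t
    rhs = solve-∀
  second-fits : t + t + (q + 1) ≤ (q + 2) * t
  second-fits = begin
    t + t + (q + 1) ≤⟨ +-monoʳ-≤ (t + t) (+-monoʳ-≤ q 1≤q) ⟩
    t + t + (q + q) ≡⟨ double q t ⟩
    t + t + q * 2   ≤⟨ +-monoʳ-≤ (t + t) (*-monoʳ-≤ q (≤-trans (s≤s 1≤s) s<t)) ⟩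
    t + t + q * t   ≡⟨ expand q t ⟩
    (q + 2) * t     ∎
    where
    double : ∀ q t → t + t + (q + q) ≡ t + t + q * 2
    double = solve-∀
    expand : ∀ q t → t + t + q * t ≡ (q + 2) * t
    expand = solve-∀

mainTheorem19 : ∀ {q ℓ : ℕ} (G : Subgroup q) (p : Word q ℓ) (s t : ℕ) →
    IsPattern G p → IsLeastPeriod G p s → HasPeriod G p t → ¬ (s ∣ t) →
    ℓ + (q + 2) ≤ (q + 2) * t
mainTheorem19 {q} {ℓ} G p s t _ s-least@(s-period@(1≤s , _) , least) t-period@(_ , t<ℓ , _) s∤t
  with ℓ + (q + 2) ≤? (q + 2) * t
... | yes bound = bound
... | no ¬bound = ⊥-elim (least (t % s) (m%n<n t s)
                   (remainder-hasPeriod {G = G} {p} {m = t / s} s-period t-period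
                      long t+t≤ℓ (m≡m%n+[m/n]*n t s) 1≤t%s))
  where
  instance _ = >-nonZero 1≤s
  1≤q : 1 ≤ q
  1≤q = ≤-trans (s≤s z≤n) (toℕ<n (p (fromℕ< t<ℓ)))
  s<t : s < t
  s<t = ≤∧≢⇒< (least-period-≤ {G = G} {p} s-least t-period) (λ s≡t → s∤t (subst (s ∣_) s≡t ∣-refl))
  1≤t%s : 1 ≤ t % s
  1≤t%s = n≢0⇒n>0 (λ t%s≡0 → s∤t (m%n≡0⇒n∣m t s t%s≡0))
  fits : q * s + (s + t) ≤ ℓ × t + t ≤ ℓ
  fits = short-period⇒long-word 1≤q 1≤s s<t (≰⇒> ¬bound)
  long : q * s + (s + t) ≤ ℓ
  long = proj₁ fits
  t+t≤ℓ : t + t ≤ ℓ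
  t+t≤ℓ = proj₂ fits
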